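{- Let $t,m,n$ be positive integers with $n\ge t\,3^t m^t$. Then $\mathbb{Z}_n$ has a $t$-free set of size $m$.
   Context: For an abelian group $G$ (written additively) and a positive integer $t$, a subset $S\subseteq G$ is $t$-free if for all non-negative integers $k,l$ with $k+l\le t$, a sum of $k$ (not necessarily distinct) elements of $S$ equals a sum of $l$ (not necessarily distinct) elements of $S$ only if $k=l$ and the two sums consist of the same terms (as multisets). $\mathbb{Z}_n$ is the cyclic group of order $n$. -}

module Defs where

open import Data.Nat using (ℕ; zero; suc; _+_; _*_; _≤_; NonZero)
open import Data.Nat.DivMod using (_%_)
open import Data.Fin using (Fin; toℕ)
open import Data.Vec.Functional using (Vector; foldr)
open import Relation.Binary.PropositionalEquality using (_≡_)
open import Function.Definitions using (Injective)

Σ : ∀ {m} → Vector ℕ m → ℕ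
Σ = foldr _+_ 0

-- A multiset of elements of a finite indexed set S = {s_0,…,s_{m-1}} is given
-- by its multiplicity vector c : Fin m → ℕ; its size is Σ c, and the sum of its
-- terms, as a natural number representative of an element of ℤ_n, is
-- Σ_i c_i · s_i.
weightedSum : ∀ {m n} → (Fin m → Fin n) → Vector ℕ m → ℕ
weightedSum s c = Σ (λ i → c i * toℕ (s i))

-- ℤ_n is modelled as Fin n (residues 0,…,n-1). A set S ⊆ ℤ_n of size m is
-- given by an injective enumeration s : Fin m → Fin n.
IsTFree : (t : ℕ) {m n : ℕ} → .{{NonZero n}} → (Fin m → Fin n) → Set
IsTFree t {m} {n} s =
  (a b : Vector ℕ m) → Σ a + Σ b ≤ t →
  weightedSum s a % n ≡ weightedSum s b % n →
  ∀ i → a i ≡ b i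

module Submission where

-- Proof idea (greedy construction in ℕ, then reduction modulo n).
--
-- Put N = 3^t·m^t.  We choose natural numbers x₀,…,x_{m-1} < N one at a time
-- so that they form a t-free set of naturals: d·y + Σ aᵢxᵢ = Σ bᵢxᵢ can only
-- hold trivially when d + Σ aᵢ + Σ bᵢ ≤ t.  Given x₀,…,x_{k-1}, a new point y
-- breaks this property only if it solves a relation d·y + Σ aᵢxᵢ = Σ bᵢxᵢ with
-- d ≥ 1 and d + Σ aᵢ + Σ bᵢ ≤ t, which determines y = (Σ bᵢxᵢ − Σ aᵢxᵢ)/d.
-- Encoding (d, a, b) as one vector of length 2k+1 with entry sum ≤ t, there are
-- at most (2k+2)^t such relations; together with the k old points this forbids
-- fewer than N values, so some y < N is allowed.
--
-- Finally, as every sum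
-- of at most t points is below t·N ≤ n, congruence mod n is equality in ℕ,
-- so the points are t-free in ℤ_n.

open import Defs
open import Data.Nat using (ℕ; _*_; _^_; _≤_; NonZero)
open import Data.Fin using (Fin)
open import Data.Product using (Σ-syntax; _×_)
open import Function.Definitions using (Injective)
open import Relation.Binary.PropositionalEquality using (_≡_)

open import Data.Nat using (zero; suc; _+_; _∸_; _<_; _≟_; s≤s; pred)
open import Data.Nat.Properties
open import Data.Nat.DivMod using (_/_; _%_; m*n/n≡m; m<n⇒m%n≡m)
open import Data.Nat.Tactic.RingSolver using (solve-∀)
open import Data.Fin using (zero; suc; toℕ; fromℕ<; splitAt; _↑ˡ_; _↑ʳ_)
open import Data.Fin.Properties using (toℕ-fromℕ<)
open import Data.Vec.Functional using (Vector; []; _∷_; head; tail; _++_; take; drop)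
open import Data.Vec.Functional.Properties using (lookup-++ˡ; lookup-++ʳ)
open import Data.List as List using (List; length; filter; tabulate)
open import Data.List.Properties using (length-++; length-map; length-tabulate; filter-notAll)
open import Data.List.Membership.Propositional using (_∈_; _∉_)
open import Data.List.Membership.Propositional.Properties
  using (∈-map⁺; ∈-++⁺ˡ; ∈-++⁺ʳ; ∈-filter⁺; ∈-tabulate⁺)
open import Data.List.Membership.DecPropositional _≟_ using (_∈?_)
import Data.List.Relation.Unary.Any as Any
open import Data.Product using (∃; _,_; proj₁; proj₂)
open import Data.Sum using (inj₁; inj₂)
open import Data.Empty using (⊥-elim)
open import Function using (_∘_)
open import Relation.Binary.PropositionalEquality
  using (refl; sym; trans; cong; cong₂; subst; _≗_; module ≡-Reasoning)
open import Relation.Binary.Definitions using (tri<; tri≈; tri>)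
open import Relation.Nullary using (¬?; yes; no)

weighted : ∀ {k} → Vector ℕ k → Vector ℕ k → ℕ
weighted x c = Σ (λ i → c i * x i)

Σ-cong : ∀ {k} {u v : Vector ℕ k} → u ≗ v → Σ u ≡ Σ v
Σ-cong {zero}  _ = refl
Σ-cong {suc k} e = cong₂ _+_ (e zero) (Σ-cong (e ∘ suc))

weighted-cong : ∀ {k} {x x′ c c′ : Vector ℕ k} → x ≗ x′ → c ≗ c′ →
                weighted x c ≡ weighted x′ c′
weighted-cong ex ec = Σ-cong (λ i → cong₂ _*_ (ec i) (ex i))

tail-++ : ∀ {k l} (a : Vector ℕ (suc k)) (b : Vector ℕ l) → tail (a ++ b) ≗ tail a ++ b
tail-++ {k} a b i with splitAt k i
... | inj₁ _ = refl
... | inj₂ _ = refl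

Σ-++ : ∀ {k l} (a : Vector ℕ k) (b : Vector ℕ l) → Σ (a ++ b) ≡ Σ a + Σ b
Σ-++ {zero}  a b = refl
Σ-++ {suc k} a b = begin
  a zero + Σ (tail (a ++ b))   ≡⟨ cong (a zero +_) (Σ-cong (tail-++ a b)) ⟩
  a zero + Σ (tail a ++ b)     ≡⟨ cong (a zero +_) (Σ-++ (tail a) b) ⟩
  a zero + (Σ (tail a) + Σ b)  ≡⟨ sym (+-assoc (a zero) _ _) ⟩
  Σ a + Σ b                    ∎
  where open ≡-Reasoning

weighted-≤ : ∀ {k} (x c : Vector ℕ k) {M} → (∀ i → x i ≤ M) → weighted x c ≤ Σ c * M
weighted-≤ {zero}  x c h = ≤-refl
weighted-≤ {suc k} x c {M} h = begin
  c zero * x zero + weighted (tail x) (tail c) ≤⟨ +-mono-≤ (*-monoʳ-≤ (c zero) (h zero))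
                                                    (weighted-≤ (tail x) (tail c) (h ∘ suc)) ⟩
  c zero * M + Σ (tail c) * M                 ≡⟨ sym (*-distribʳ-+ M (c zero) _) ⟩
  Σ c * M                                     ∎
  where open ≤-Reasoning

_∈ᵥ_ : ∀ {k} → Vector ℕ k → List (Vector ℕ k) → Set
c ∈ᵥ L = ∃ λ w → w ∈ L × w ≗ c

incHead : ∀ {k} → Vector ℕ (suc k) → Vector ℕ (suc k)
incHead c = suc (head c) ∷ tail c

-- A list of all vectors of length k with entry sum at most s: either the head
-- is 0, or it is positive and decrementing it leaves entry sum at most s − 1.
bounded : ∀ k → ℕ → List (Vector ℕ k)
bounded zero    s       = List.[ [] ]
bounded (suc k) zero    = List.map (0 ∷_) (bounded k zero)
bounded (suc k) (suc s) = List.map (0 ∷_) (bounded k (suc s))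
                     List.++ List.map incHead (bounded (suc k) s)

-- The recursion gives L(k+1, s+1) = L(k, s+1) + L(k+1, s) ≤ (k+1)^(s+1) + (k+2)^s.
length-bounded : ∀ k s → length (bounded k s) ≤ suc k ^ s
length-bounded zero    s       = ≤-reflexive (sym (^-zeroˡ s))
length-bounded (suc k) zero    = ≤-trans (≤-reflexive (length-map (0 ∷_) (bounded k zero)))
                                         (length-bounded k zero)
length-bounded (suc k) (suc s) = begin
  length (List.map (0 ∷_) (bounded k (suc s)) List.++ List.map incHead (bounded (suc k) s))
    ≡⟨ trans (length-++ (List.map (0 ∷_) (bounded k (suc s))))
             (cong₂ _+_ (length-map (0 ∷_) (bounded k (suc s))) (length-map incHead (bounded (suc k) s))) ⟩
  length (bounded k (suc s)) + length (bounded (suc k) s)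
    ≤⟨ +-mono-≤ (length-bounded k (suc s)) (length-bounded (suc k) s) ⟩
  suc k * suc k ^ s + B ^ s
    ≤⟨ +-monoˡ-≤ (B ^ s) (*-monoʳ-≤ (suc k) (^-monoˡ-≤ s (n≤1+n (suc k)))) ⟩
  suc k * B ^ s + B ^ s
    ≡⟨ +-comm (suc k * B ^ s) (B ^ s) ⟩
  B ^ suc s ∎
  where
  open ≤-Reasoning
  B = suc (suc k)

0∷-∈-bounded : ∀ {k} s {w : Vector ℕ k} → w ∈ bounded k s → (0 ∷ w) ∈ bounded (suc k) s
0∷-∈-bounded zero    w∈ = ∈-map⁺ (0 ∷_) w∈
0∷-∈-bounded (suc s) w∈ = ∈-++⁺ˡ (∈-map⁺ (0 ∷_) w∈)

mutual
  bounded-complete : ∀ k s (c : Vector ℕ k) → Σ c ≤ s → c ∈ᵥ bounded k s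
  bounded-complete zero    s c _  = [] , Any.here refl , λ ()
  bounded-complete (suc k) s c le with bounded-complete-∷ k s (head c) (tail c) le
  ... | w , w∈ , e = w , w∈ , λ { zero → e zero ; (suc i) → e (suc i) }

  bounded-complete-∷ : ∀ k s h (c : Vector ℕ k) → h + Σ c ≤ s → (h ∷ c) ∈ᵥ bounded (suc k) s
  bounded-complete-∷ k s zero c le with bounded-complete k s c le
  ... | w , w∈ , e = 0 ∷ w , 0∷-∈-bounded s w∈ , λ { zero → refl ; (suc i) → e i }
  bounded-complete-∷ k (suc s) (suc h) c (s≤s le) with bounded-complete-∷ k s h c le
  ... | w , w∈ , e = incHead w
                   , ∈-++⁺ʳ (List.map (0 ∷_) (bounded k (suc s))) (∈-map⁺ incHead w∈)
                   , λ { zero → cong suc (e zero) ; (suc i) → e (suc i) }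

missing : ∀ N (L : List ℕ) → length L < N → ∃ λ y → y < N × y ∉ L
missing (suc N) L len with N ∈? L
... | no N∉L = N , ≤-refl , N∉L
... | yes N∈L with missing N (filter (λ z → ¬? (z ≟ N)) L) shorter
  where
  shorter : length (filter (λ z → ¬? (z ≟ N)) L) < N
  shorter = ≤-trans (filter-notAll (λ z → ¬? (z ≟ N)) L (Any.map (λ N≡z z≢N → z≢N (sym N≡z)) N∈L))
                    (≤-pred len)
... | y , y<N , y∉ = y , m<n⇒m<1+n y<N , λ y∈L → y∉ (∈-filter⁺ (λ z → ¬? (z ≟ N)) y∈L (<⇒≢ y<N))

-- The unique y with d·y + u = v (when d ≥ 1 and such y exists).
solveFor : ℕ → ℕ → ℕ → ℕ
solveFor zero    u v = 0
solveFor (suc d) u v = (v ∸ u) / suc d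

solveFor-correct : ∀ d y u → solveFor (suc d) u (suc d * y + u) ≡ y
solveFor-correct d y u = begin
  (suc d * y + u ∸ u) / suc d ≡⟨ cong (_/ suc d) (m+n∸n≡m (suc d * y) u) ⟩
  (suc d * y) / suc d         ≡⟨ cong (_/ suc d) (*-comm (suc d) y) ⟩
  (y * suc d) / suc d         ≡⟨ m*n/n≡m y (suc d) ⟩
  y                           ∎
  where open ≡-Reasoning

-- A relation over k points is a vector r = d ∷ (a ++ b), read as
-- d·y + Σ aᵢxᵢ = Σ bᵢxᵢ; its size is Σ r.  The candidate is the y it forces.
candidate : ∀ {k} → Vector ℕ k → Vector ℕ (suc (k + k)) → ℕ
candidate {k} x r = solveFor (head r) (weighted x (take k (tail r))) (weighted x (drop k (tail r)))

candidate-cong : ∀ {k} (x : Vector ℕ k) {r r′} → r ≗ r′ → candidate x r ≡ candidate x r′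
candidate-cong {k} x e = cong₂ (λ d uv → solveFor d (proj₁ uv) (proj₂ uv))
  (e zero)
  (cong₂ _,_ (weighted-cong (λ _ → refl) (λ i → e (suc (i ↑ˡ k))))
             (weighted-cong (λ _ → refl) (λ i → e (suc (k ↑ʳ i)))))

-- Values that may not be added to x: candidates of relations of size ≤ t, and
-- the points of x themselves.
forbidden : ∀ {k} → ℕ → Vector ℕ k → List ℕ
forbidden {k} t x = List.map (candidate x) (bounded (suc (k + k)) t) List.++ tabulate x

length-forbidden : ∀ {k} t (x : Vector ℕ k) → length (forbidden t x) ≤ (2 + k + k) ^ t + k
length-forbidden {k} t x = begin
  length (List.map (candidate x) (bounded (suc (k + k)) t) List.++ tabulate x)
    ≡⟨ trans (length-++ (List.map (candidate x) (bounded (suc (k + k)) t)))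
             (cong₂ _+_ (length-map (candidate x) (bounded (suc (k + k)) t)) (length-tabulate x)) ⟩
  length (bounded (suc (k + k)) t) + k
    ≤⟨ +-monoˡ-≤ k (length-bounded (suc (k + k)) t) ⟩
  (2 + k + k) ^ t + k ∎
  where open ≤-Reasoning

relation⇒forbidden : ∀ {k} t (x : Vector ℕ k) y d (a b : Vector ℕ k) →
  suc d + (Σ a + Σ b) ≤ t → suc d * y + weighted x a ≡ weighted x b → y ∈ forbidden t x
relation⇒forbidden {k} t x y d a b size eq
  with bounded-complete (suc (k + k)) t (suc d ∷ (a ++ b)) (subst (λ z → suc d + z ≤ t) (sym (Σ-++ a b)) size)
... | w , w∈ , w≗r = ∈-++⁺ˡ (subst (_∈ List.map (candidate x) _) forced (∈-map⁺ (candidate x) w∈))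
  where
  open ≡-Reasoning
  forced : candidate x w ≡ y
  forced = begin
    candidate x w                                   ≡⟨ candidate-cong x w≗r ⟩
    solveFor (suc d) (weighted x (take k (a ++ b))) (weighted x (drop k (a ++ b)))
      ≡⟨ cong₂ (solveFor (suc d)) (weighted-cong (λ _ → refl) (lookup-++ˡ a b))
                                  (weighted-cong (λ _ → refl) (lookup-++ʳ a b)) ⟩
    solveFor (suc d) (weighted x a) (weighted x b)  ≡⟨ cong (solveFor (suc d) (weighted x a)) (sym eq) ⟩
    solveFor (suc d) (weighted x a) (suc d * y + weighted x a) ≡⟨ solveFor-correct d y (weighted x a) ⟩
    y                                               ∎

FreeInℕ : ℕ → ∀ {k} → Vector ℕ k → Set
FreeInℕ t {k} x = (a b : Vector ℕ k) → Σ a + Σ b ≤ t → weighted x a ≡ weighted x b → a ≗ b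

-- If the multiplicities of the new point y differ on both sides, cancelling
-- the smaller one leaves a relation of size ≤ t solved by y.
unequal-heads⇒forbidden : ∀ {k} t (x : Vector ℕ k) y (a b : Vector ℕ (suc k)) →
  a zero < b zero → Σ a + Σ b ≤ t → weighted (y ∷ x) a ≡ weighted (y ∷ x) b → y ∈ forbidden t x
unequal-heads⇒forbidden t x y a b a₀<b₀ size eq with m≤n⇒∃[o]m+o≡n a₀<b₀
... | d , a₀+1+d≡b₀ = relation⇒forbidden t x y d (tail b) (tail a) size′ eq′
  where
  p : ℕ
  p = a zero
  identity : ∀ p d y B → (suc p + d) * y + B ≡ p * y + (suc d * y + B)
  identity = solve-∀
  eq′ : suc d * y + weighted x (tail b) ≡ weighted x (tail a)
  eq′ = sym (+-cancelˡ-≡ (p * y) _ _ (trans eq (trans (cong (λ q → q * y + weighted x (tail b)) (sym a₀+1+d≡b₀))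
                                                     (identity p d y _))))
  -- The new relation is no larger: d + 1 ≤ b₀ and the a-side loses a₀.
  size′ : suc d + (Σ (tail b) + Σ (tail a)) ≤ t
  size′ = ≤-trans (≤-reflexive (sym (+-assoc (suc d) _ _)))
            (≤-trans (+-mono-≤ (+-monoˡ-≤ (Σ (tail b)) (subst (suc d ≤_) a₀+1+d≡b₀ (s≤s (m≤n+m d p))))
                               (m≤n+m (Σ (tail a)) p))
                     (≤-trans (≤-reflexive (+-comm (Σ b) (Σ a))) size))

free-extend : ∀ {k} t (x : Vector ℕ k) y → FreeInℕ t x → y ∉ forbidden t x → FreeInℕ t (y ∷ x)
free-extend t x y free y∉ a b size eq with <-cmp (a zero) (b zero)
... | tri< a₀<b₀ _ _ = ⊥-elim (y∉ (unequal-heads⇒forbidden t x y a b a₀<b₀ size eq))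
... | tri> _ _ b₀<a₀ = ⊥-elim (y∉ (unequal-heads⇒forbidden t x y b a b₀<a₀
                                      (subst (_≤ t) (+-comm (Σ a) (Σ b)) size) (sym eq)))
... | tri≈ _ a₀≡b₀ _ = λ { zero → a₀≡b₀ ; (suc i) → tails i }
  where
  tails : tail a ≗ tail b
  tails = free (tail a) (tail b)
    (≤-trans (+-mono-≤ (m≤n+m (Σ (tail a)) (a zero)) (m≤n+m (Σ (tail b)) (b zero))) size)
    (+-cancelˡ-≡ (b zero * y) _ _ (trans (cong (λ q → q * y + weighted x (tail a)) (sym a₀≡b₀)) eq))

injective-extend : ∀ {k} t (x : Vector ℕ k) y → Injective _≡_ _≡_ x → y ∉ forbidden t x →
                   Injective _≡_ _≡_ (y ∷ x)
injective-extend t x y inj y∉ {zero}  {zero}  _ = refl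
injective-extend t x y inj y∉ {zero}  {suc j} e = ⊥-elim (y∉ (∈-++⁺ʳ _ (subst (_∈ tabulate x) (sym e) (∈-tabulate⁺ j))))
injective-extend t x y inj y∉ {suc i} {zero}  e = ⊥-elim (y∉ (∈-++⁺ʳ _ (subst (_∈ tabulate x) e (∈-tabulate⁺ i))))
injective-extend t x y inj y∉ {suc i} {suc j} e = cong suc (inj e)

record FreeFamily (t N k : ℕ) : Set where
  field
    points    : Vector ℕ k
    injective : Injective _≡_ _≡_ points
    free      : FreeInℕ t points
    below     : ∀ i → points i < N

greedy : ∀ t N k → (∀ j → j < k → (2 + j + j) ^ t + j < N) → FreeFamily t N k
greedy t N zero    _     = record { points = [] ; injective = λ { {()} } ; free = λ _ _ _ _ () ; below = λ () }
greedy t N (suc k) small with greedy t N k (λ j j<k → small j (m<n⇒m<1+n j<k))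
... | F with missing N (forbidden t (FreeFamily.points F))
               (≤-<-trans (length-forbidden t (FreeFamily.points F)) (small k ≤-refl))
... | y , y<N , y∉ = record
  { points    = y ∷ x
  ; injective = injective-extend t x y (FreeFamily.injective F) y∉
  ; free      = free-extend t x y (FreeFamily.free F) y∉
  ; below     = λ { zero → y<N ; (suc i) → FreeFamily.below F i }
  }
  where
  x : Vector ℕ k
  x = FreeFamily.points F

^-distrib-* : ∀ a b n → (a * b) ^ n ≡ a ^ n * b ^ n
^-distrib-* a b zero    = refl
^-distrib-* a b (suc n) = trans (cong (a * b *_) (^-distrib-* a b n)) (rearrange a b (a ^ n) (b ^ n))
  where
  rearrange : ∀ a b p q → a * b * (p * q) ≡ a * p * (b * q)
  rearrange = solve-∀

-- For c ≥ 1, a^(t+1) + c ≤ (c + a)^(t+1): split (c + a)^(t+1) = a·(c + a)^t + c·(c + a)^t.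
^-superadditive : ∀ a c t .{{_ : NonZero c}} → a ^ suc t + c ≤ (c + a) ^ suc t
^-superadditive a c@(suc _) t = begin
  a * a ^ t + c                     ≤⟨ +-mono-≤ (*-monoʳ-≤ a (^-monoˡ-≤ t (m≤n+m a c)))
                                                (m≤m*n c ((c + a) ^ t) {{m^n≢0 (c + a) t}}) ⟩
  a * (c + a) ^ t + c * (c + a) ^ t ≡⟨ sym (*-distribʳ-+ ((c + a) ^ t) a c) ⟩
  (a + c) * (c + a) ^ t             ≡⟨ cong (_* (c + a) ^ t) (+-comm a c) ⟩
  (c + a) ^ suc t                   ∎
  where open ≤-Reasoning

count-bound : ∀ t m j .{{_ : NonZero t}} .{{_ : NonZero m}} → j < m → (2 + j + j) ^ t + j < 3 ^ t * m ^ t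
count-bound t@(suc t′) m j j<m = begin-strict
  (2 + j + j) ^ t + j    ≤⟨ +-monoˡ-≤ j (^-monoˡ-≤ t (subst (_≤ 2 * m) (double j) (*-monoʳ-≤ 2 j<m))) ⟩
  (2 * m) ^ t + j        <⟨ +-monoʳ-< ((2 * m) ^ t) j<m ⟩
  (2 * m) ^ t + m        ≤⟨ ^-superadditive (2 * m) m t′ ⟩
  (m + 2 * m) ^ t        ≡⟨ cong (_^ t) (triple m) ⟩
  (3 * m) ^ t            ≡⟨ ^-distrib-* 3 m t ⟩
  3 ^ t * m ^ t          ∎
  where
  open ≤-Reasoning
  double : ∀ j → 2 * suc j ≡ 2 + j + j
  double = solve-∀
  triple : ∀ m → m + 2 * m ≡ 3 * m
  triple = solve-∀

weighted-< : ∀ {k} t N .{{_ : NonZero t}} .{{_ : NonZero N}} (x c : Vector ℕ k) →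
             (∀ i → x i < N) → Σ c ≤ t → weighted x c < t * N
weighted-< t N x c below size = begin-strict
  weighted x c  ≤⟨ weighted-≤ x c (<⇒≤pred ∘ below) ⟩
  Σ c * pred N  ≤⟨ *-monoˡ-≤ (pred N) size ⟩
  t * pred N    <⟨ *-monoʳ-< t (≤-reflexive (suc-pred N)) ⟩
  t * N         ∎
  where open ≤-Reasoning

-- When t·N ≤ n, congruence mod n of such sums is equality, so a t-free family
-- of naturals below N is a t-free subset of ℤ_n.
reduce-mod : ∀ t N m n .{{_ : NonZero t}} .{{_ : NonZero N}} .{{_ : NonZero n}} →
  t * N ≤ n → FreeFamily t N m → Σ[ s ∈ (Fin m → Fin n) ] (Injective _≡_ _≡_ s × IsTFree t s)
reduce-mod t N m n tN≤n F = s , s-injective , s-free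
  where
  open FreeFamily F using (points; injective; free; below)
  N≤n : N ≤ n
  N≤n = ≤-trans (m≤n*m N t) tN≤n
  s : Fin m → Fin n
  s i = fromℕ< (<-≤-trans (below i) N≤n)
  toℕ-s : ∀ i → toℕ (s i) ≡ points i
  toℕ-s i = toℕ-fromℕ< (<-≤-trans (below i) N≤n)
  s-injective : Injective _≡_ _≡_ s
  s-injective {i} {j} e = injective (trans (sym (toℕ-s i)) (trans (cong toℕ e) (toℕ-s j)))
  reduced : ∀ c → Σ c ≤ t → weightedSum s c % n ≡ weighted points c
  reduced c size = trans (cong (_% n) (weighted-cong {x = toℕ ∘ s} {c = c} toℕ-s (λ _ → refl)))
                         (m<n⇒m%n≡m (<-≤-trans (weighted-< t N points c below size) tN≤n))
  s-free : IsTFree t s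
  s-free a b size e = free a b size
    (trans (sym (reduced a (≤-trans (m≤m+n (Σ a) (Σ b)) size)))
           (trans e (reduced b (≤-trans (m≤n+m (Σ b) (Σ a)) size))))

proposition14 : (t m n : ℕ) → .{{_ : NonZero t}} → .{{_ : NonZero m}} → .{{_ : NonZero n}} →
    t * 3 ^ t * m ^ t ≤ n →
    Σ[ s ∈ (Fin m → Fin n) ] (Injective _≡_ _≡_ s × IsTFree t s)
proposition14 t m n hn =
  reduce-mod t N m n (subst (_≤ n) (*-assoc t (3 ^ t) (m ^ t)) hn)
    (greedy t N m (λ j j<m → count-bound t m j j<m))
  where
  N : ℕ
  N = 3 ^ t * m ^ t
  instance
    N≢0 : NonZero N
    N≢0 = m*n≢0 (3 ^ t) (m ^ t) {{m^n≢0 3 t}} {{m^n≢0 m t}}
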